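{- Let $(a_n)_{n\ge 0}$ be a sequence of real numbers and $S_n(q)=\sum_{k=0}^{n}a_k\binom{n}{k}(1-q)^kq^{n-k}$. For any positive integer $m$ and every $n\ge0$, $$S_n(q^m)=\sum_{k=0}^{n}S_k\bigl(1-[q]_m\bigr)\binom{n}{k}(1-q)^kq^{n-k},\qquad S_n(q^m)=\sum_{k=0}^{n}S_k(q)\binom{n}{k}\bigl([q]_m\bigr)^k\bigl(1-[q]_m\bigr)^{n-k}.$$ When $q\in\,]0,1[$ (letting $m\to\infty$) these give $$a_n=\sum_{k=0}^{n}S_k\!\left(-\frac{q}{1-q}\right)\binom{n}{k}(1-q)^kq^{n-k}=\frac{1}{(1-q)^n}\sum_{k=0}^{n}S_k(q)\binom{n}{k}(-q)^{n-k}.$$ Also, for any real number $\alpha$ (and $q\neq 1$), $$S_n((\alpha+1)q)=\sum_{k=0}^{n}S_k\!\left(\frac{\alpha q}{1-q}\right)\binom{n}{k}(1-q)^kq^{n-k},\qquad S_n((\alpha+1)q)=\frac{1}{(1-q)^n}\sum_{k=0}^{n}S_k(q)\binom{n}{k}\bigl(1-(\alpha+1)q\bigr)^k(\alpha q)^{n-k}.$$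
   Context: For a positive integer $m$, $[q]_m=1+q+\cdots+q^{m-1}$. -}

module Defs where

open import Level using (Level)
open import Data.Nat as ℕ using (ℕ; zero; suc; _∸_)
open import Data.Nat.Combinatorics using (_C_)
open import Algebra.Bundles using (CommutativeRing)

-- Operations over an arbitrary commutative ring R (standing in for ℝ).
module Ops {c ℓ : Level} (R : CommutativeRing c ℓ) where
  open CommutativeRing R

  pow : Carrier → ℕ → Carrier
  pow x zero    = 1#
  pow x (suc n) = x * pow x n

  fromℕ : ℕ → Carrier
  fromℕ zero    = 0#
  fromℕ (suc n) = 1# + fromℕ n

  binom : ℕ → ℕ → Carrier
  binom n k = fromℕ (n C k)

  sumTo : ℕ → (ℕ → Carrier) → Carrier
  sumTo zero    f = f 0
  sumTo (suc n) f = sumTo n f + f (suc n)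

  sumBelow : ℕ → (ℕ → Carrier) → Carrier
  sumBelow zero    f = 0#
  sumBelow (suc m) f = sumBelow m f + f m

  qint : ℕ → Carrier → Carrier
  qint m q = sumBelow m (λ i → pow q i)

  S : (ℕ → Carrier) → ℕ → Carrier → Carrier
  S a n q = sumTo n (λ k → a k * binom n k * pow (1# - q) k * pow q (n ∸ k))

module Submission where

-- Write T(x, y) for the transform a ↦ (n ↦ Σₖ aₖ (n choose k) xᵏ yⁿ⁻ᵏ) (binomialSum below),
-- so that S_q = T(1 - q, q) and T(1, 0) is the identity. By Pascal's rule T(x, y) satisfies
--   T(x, y) a (n + 1) = y · T(x, y) a n + x · T(x, y) (a ∘ suc) n,
-- and induction on n with this recurrence shows that these transforms compose like affine maps:
--   T(x′, y′) ∘ T(x, y) = T(x′ x, y′ + x′ y).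
-- Each of the six formulas is one such composition; the parameters match because
-- (1 - q) [q]ₘ = 1 - qᵐ, resp. u (1 - q) = 1. In the second forms the factor uⁿ is absorbed
-- by the homogeneity T(x u, y u) a n = uⁿ T(x, y) a n.

open import Level using (Level)
open import Algebra.Bundles using (CommutativeRing)
open import Algebra.Solver.Ring.AlmostCommutativeRing
  using (fromCommutativeRing; _-Raw-AlmostCommutative⟶_; Induced-equivalence)
open import Data.Integer as ℤ using (ℤ; +_; -[1+_]; _⊖_)
import Data.Integer.Properties as ℤ
open import Data.Maybe as Maybe using ()
open import Data.Nat as ℕ using (ℕ; zero; suc; _≤_; _∸_)
import Data.Nat.Properties as ℕ
open import Data.Nat.Combinatorics using (_C_; nCk+nC[k+1]≡[n+1]C[k+1]; k>n⇒nCk≡0)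
open import Data.Product using (_×_; _,_)
open import Relation.Binary.Definitions using (WeaklyDecidable)
open import Relation.Binary.PropositionalEquality using (cong)
open import Relation.Nullary.Decidable using (yes; no; dec⇒maybe)
open import Defs

-- The ring solver compares normal forms up to computation, so it needs coefficients on which
-- 1 - 1 computes to 0: we use ℤ through its canonical image in R. The optimised ×′ makes
-- fromℤ (+ 1) reduce to 1#, so that the solver's constants match the ring's.
module IntegerCoefficients {c ℓ : Level} (R : CommutativeRing c ℓ) where
  open CommutativeRing R
  open import Algebra.Properties.Ring ring
    using (-0#≈0#; -‿involutive; -‿+-comm; xyx⁻¹≈y; -‿distribˡ-*; -‿distribʳ-*)
  open import Algebra.Properties.Semiring.Mult.TCOptimised semiring
    using (1+×; ×-homo-+; ×1-homo-*) renaming (_×_ to _×′_)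
  open import Relation.Binary.Reasoning.Setoid setoid

  fromℤ : ℤ → Carrier
  fromℤ (+ n)    = n ×′ 1#
  fromℤ -[1+ n ] = - (suc n ×′ 1#)

  fromℤ-neg : ∀ i → fromℤ (ℤ.- i) ≈ - fromℤ i
  fromℤ-neg (+ zero)  = sym -0#≈0#
  fromℤ-neg (+ suc n) = refl
  fromℤ-neg -[1+ n ]  = sym (-‿involutive _)

  fromℤ-⊖ : ∀ m n → fromℤ (m ⊖ n) ≈ m ×′ 1# - n ×′ 1#
  fromℤ-⊖ zero    zero    = sym (-‿inverseʳ 0#)
  fromℤ-⊖ (suc m) zero    = sym (trans (+-congˡ -0#≈0#) (+-identityʳ _))
  fromℤ-⊖ zero    (suc n) = sym (+-identityˡ _)
  fromℤ-⊖ (suc m) (suc n) = begin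
    fromℤ (suc m ⊖ suc n)            ≡⟨ cong fromℤ (ℤ.[1+m]⊖[1+n]≡m⊖n m n) ⟩
    fromℤ (m ⊖ n)                    ≈⟨ fromℤ-⊖ m n ⟩
    m ×′ 1# - n ×′ 1#                ≈⟨ +-congʳ (xyx⁻¹≈y 1# (m ×′ 1#)) ⟨
    1# + m ×′ 1# - 1# - n ×′ 1#      ≈⟨ +-assoc _ _ _ ⟩
    1# + m ×′ 1# + (- 1# - n ×′ 1#)  ≈⟨ +-congˡ (-‿+-comm 1# (n ×′ 1#)) ⟩
    1# + m ×′ 1# - (1# + n ×′ 1#)    ≈⟨ +-cong (1+× m 1#) (-‿cong (1+× n 1#)) ⟨
    suc m ×′ 1# - suc n ×′ 1#        ∎

  fromℤ-+ : ∀ i j → fromℤ (i ℤ.+ j) ≈ fromℤ i + fromℤ j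
  fromℤ-+ (+ m)    (+ n)    = ×-homo-+ 1# m n
  fromℤ-+ (+ m)    -[1+ n ] = fromℤ-⊖ m (suc n)
  fromℤ-+ -[1+ m ] (+ n)    = trans (fromℤ-⊖ n (suc m)) (+-comm _ _)
  fromℤ-+ -[1+ m ] -[1+ n ] = begin
    fromℤ (-[1+ m ] ℤ.+ -[1+ n ])  ≡⟨ cong fromℤ (ℤ.neg-distrib-+ (+ suc m) (+ suc n)) ⟨
    - ((suc m ℕ.+ suc n) ×′ 1#)    ≈⟨ -‿cong (×-homo-+ 1# (suc m) (suc n)) ⟩
    - (suc m ×′ 1# + suc n ×′ 1#)  ≈⟨ -‿+-comm _ _ ⟨
    - (suc m ×′ 1#) - suc n ×′ 1#  ∎

  fromℤ-*-pos : ∀ m j → fromℤ (+ m ℤ.* j) ≈ m ×′ 1# * fromℤ j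
  fromℤ-*-pos m (+ n) = begin
    fromℤ (+ m ℤ.* + n)  ≡⟨ cong fromℤ (ℤ.pos-* m n) ⟨
    (m ℕ.* n) ×′ 1#      ≈⟨ ×1-homo-* m n ⟩
    m ×′ 1# * n ×′ 1#    ∎
  fromℤ-*-pos m -[1+ n ] = begin
    fromℤ (+ m ℤ.* ℤ.- + suc n)    ≡⟨ cong fromℤ (ℤ.neg-distribʳ-* (+ m) (+ suc n)) ⟨
    fromℤ (ℤ.- (+ m ℤ.* + suc n))  ≈⟨ fromℤ-neg (+ m ℤ.* + suc n) ⟩
    - fromℤ (+ m ℤ.* + suc n)      ≈⟨ -‿cong (fromℤ-*-pos m (+ suc n)) ⟩
    - (m ×′ 1# * suc n ×′ 1#)      ≈⟨ -‿distribʳ-* _ _ ⟩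
    m ×′ 1# * - (suc n ×′ 1#)      ∎

  fromℤ-* : ∀ i j → fromℤ (i ℤ.* j) ≈ fromℤ i * fromℤ j
  fromℤ-* (+ m)    j = fromℤ-*-pos m j
  fromℤ-* -[1+ m ] j = begin
    fromℤ (ℤ.- + suc m ℤ.* j)    ≡⟨ cong fromℤ (ℤ.neg-distribˡ-* (+ suc m) j) ⟨
    fromℤ (ℤ.- (+ suc m ℤ.* j))  ≈⟨ fromℤ-neg (+ suc m ℤ.* j) ⟩
    - fromℤ (+ suc m ℤ.* j)      ≈⟨ -‿cong (fromℤ-*-pos (suc m) j) ⟩
    - (suc m ×′ 1# * fromℤ j)    ≈⟨ -‿distribˡ-* _ _ ⟩
    - (suc m ×′ 1#) * fromℤ j    ∎

  fromℤ-homomorphism : ℤ.+-*-rawRing -Raw-AlmostCommutative⟶ fromCommutativeRing R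
  fromℤ-homomorphism = record
    { ⟦_⟧    = fromℤ
    ; +-homo = fromℤ-+
    ; *-homo = fromℤ-*
    ; -‿homo = fromℤ-neg
    ; 0-homo = refl
    ; 1-homo = refl
    }

  fromℤ-≟ : WeaklyDecidable (Induced-equivalence fromℤ-homomorphism)
  fromℤ-≟ i j = Maybe.map (λ i≡j → reflexive (cong fromℤ i≡j)) (dec⇒maybe (i ℤ.≟ j))

  open import Algebra.Solver.Ring ℤ.+-*-rawRing (fromCommutativeRing R) fromℤ-homomorphism fromℤ-≟ public

  :0 :1 : ∀ {n} → Polynomial n
  :0 = con (+ 0)
  :1 = con (+ 1)


module BinomialSums {c ℓ : Level} (R : CommutativeRing c ℓ) where
  open CommutativeRing R
  open Ops R
  open IntegerCoefficients R using (solve; _:=_; _:+_; _:*_; _:-_; :-_; :0; :1)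
  open import Algebra.Properties.CommutativeSemigroup +-commutativeSemigroup
    using () renaming (interchange to +-interchange)
  open import Algebra.Properties.CommutativeSemigroup *-commutativeSemigroup
    using (x∙yz≈y∙xz) renaming (interchange to *-interchange)
  open import Relation.Binary.Reasoning.Setoid setoid

  sumTo-cong : ∀ n {f g : ℕ → Carrier} → (∀ {k} → k ≤ n → f k ≈ g k) → sumTo n f ≈ sumTo n g
  sumTo-cong zero    f≈g = f≈g ℕ.z≤n
  sumTo-cong (suc n) f≈g = +-cong (sumTo-cong n (λ k≤n → f≈g (ℕ.m≤n⇒m≤1+n k≤n))) (f≈g ℕ.≤-refl)

  sumTo-distrib-+ : ∀ n (f g : ℕ → Carrier) → sumTo n (λ k → f k + g k) ≈ sumTo n f + sumTo n g
  sumTo-distrib-+ zero    f g = refl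
  sumTo-distrib-+ (suc n) f g = trans (+-congʳ (sumTo-distrib-+ n f g)) (+-interchange _ _ _ _)

  *-distribˡ-sumTo : ∀ x n (f : ℕ → Carrier) → x * sumTo n f ≈ sumTo n (λ k → x * f k)
  *-distribˡ-sumTo x zero    f = refl
  *-distribˡ-sumTo x (suc n) f = trans (distribˡ x _ _) (+-congʳ (*-distribˡ-sumTo x n f))

  sumTo-uncons : ∀ n (f : ℕ → Carrier) → sumTo (suc n) f ≈ f 0 + sumTo n (λ k → f (suc k))
  sumTo-uncons zero    f = refl
  sumTo-uncons (suc n) f = trans (+-congʳ (sumTo-uncons n f)) (+-assoc _ _ _)

  fromℕ-+ : ∀ m n → fromℕ (m ℕ.+ n) ≈ fromℕ m + fromℕ n
  fromℕ-+ zero    n = sym (+-identityˡ _)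
  fromℕ-+ (suc m) n = trans (+-congˡ (fromℕ-+ m n)) (sym (+-assoc _ _ _))

  binom-pascal : ∀ n k → binom (suc n) (suc k) ≈ binom n k + binom n (suc k)
  binom-pascal n k = begin
    fromℕ (suc n C suc k)           ≡⟨ cong fromℕ (nCk+nC[k+1]≡[n+1]C[k+1] n k) ⟨
    fromℕ (n C k ℕ.+ n C suc k)     ≈⟨ fromℕ-+ (n C k) (n C suc k) ⟩
    binom n k + binom n (suc k)     ∎

  binom-vanishes : ∀ {n k} → n ℕ.< k → binom n k ≈ 0#
  binom-vanishes n<k = reflexive (cong fromℕ (k>n⇒nCk≡0 n<k))

  binom-suc-*-pow-∸ : ∀ n k y → binom n (suc k) * pow y (n ∸ k) ≈ y * (binom n (suc k) * pow y (n ∸ suc k))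
  binom-suc-*-pow-∸ n k y with k ℕ.<? n
  ... | yes k<n = begin
    binom n (suc k) * pow y (n ∸ k)               ≡⟨ cong (λ i → binom n (suc k) * pow y i) (ℕ.+-∸-assoc 1 k<n) ⟩
    binom n (suc k) * (y * pow y (n ∸ suc k))     ≈⟨ x∙yz≈y∙xz _ y _ ⟩
    y * (binom n (suc k) * pow y (n ∸ suc k))     ∎
  ... | no k≮n = begin
    binom n (suc k) * pow y (n ∸ k)               ≈⟨ *-congʳ B≈0 ⟩
    0# * pow y (n ∸ k)                            ≈⟨ zeroˡ _ ⟩
    0#                                            ≈⟨ zeroʳ y ⟨
    y * 0#                                        ≈⟨ *-congˡ (zeroˡ _) ⟨
    y * (0# * pow y (n ∸ suc k))                  ≈⟨ *-congˡ (*-congʳ B≈0) ⟨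
    y * (binom n (suc k) * pow y (n ∸ suc k))     ∎
    where B≈0 = binom-vanishes (ℕ.s≤s (ℕ.≮⇒≥ k≮n))

  pow-+ : ∀ x m n → pow x (m ℕ.+ n) ≈ pow x m * pow x n
  pow-+ x zero    n = sym (*-identityˡ _)
  pow-+ x (suc m) n = trans (*-congˡ (pow-+ x m n)) (sym (*-assoc _ _ _))

  pow-distrib-* : ∀ x y n → pow (x * y) n ≈ pow x n * pow y n
  pow-distrib-* x y zero    = sym (*-identityˡ 1#)
  pow-distrib-* x y (suc n) = trans (*-congˡ (pow-distrib-* x y n)) (*-interchange x y _ _)

  pow-1# : ∀ n → pow 1# n ≈ 1#
  pow-1# zero    = refl
  pow-1# (suc n) = trans (*-identityˡ _) (pow-1# n)

  binomialSum : (ℕ → Carrier) → ℕ → Carrier → Carrier → Carrier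
  binomialSum a n x y = sumTo n (λ k → a k * binom n k * pow x k * pow y (n ∸ k))

  binomialSum-zero : ∀ a x y → binomialSum a 0 x y ≈ a 0
  binomialSum-zero a x y = solve 1 (λ a₀ → a₀ :* (:1 :+ :0) :* :1 :* :1 := a₀) refl (a 0)

  binomialSum-cong : ∀ n {a b : ℕ → Carrier} x y → (∀ k → a k ≈ b k) → binomialSum a n x y ≈ binomialSum b n x y
  binomialSum-cong n x y a≈b = sumTo-cong n (λ {k} _ → *-congʳ (*-congʳ (*-congʳ (a≈b k))))

  binomialSum-linear : ∀ n p r (b d : ℕ → Carrier) x y →
    binomialSum (λ k → p * b k + r * d k) n x y ≈ p * binomialSum b n x y + r * binomialSum d n x y
  binomialSum-linear n p r b d x y = begin
    binomialSum (λ k → p * b k + r * d k) n x y                   ≈⟨ sumTo-cong n (λ {k} _ → distribute k) ⟩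
    sumTo n (λ k → p * term b k + r * term d k)                   ≈⟨ sumTo-distrib-+ n _ _ ⟩
    sumTo n (λ k → p * term b k) + sumTo n (λ k → r * term d k)   ≈⟨ +-cong (*-distribˡ-sumTo p n (term b)) (*-distribˡ-sumTo r n (term d)) ⟨
    p * binomialSum b n x y + r * binomialSum d n x y             ∎
    where
      term : (ℕ → Carrier) → ℕ → Carrier
      term e k = e k * binom n k * pow x k * pow y (n ∸ k)
      distribute : ∀ k → (p * b k + r * d k) * binom n k * pow x k * pow y (n ∸ k) ≈ p * term b k + r * term d k
      distribute k = solve 7 (λ P Q β δ B X Y → (P :* β :+ Q :* δ) :* B :* X :* Y
                                              := P :* (β :* B :* X :* Y) :+ Q :* (δ :* B :* X :* Y))
                       refl p r (b k) (d k) (binom n k) (pow x k) (pow y (n ∸ k))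

  binomialSum-suc : ∀ a n x y →
    binomialSum a (suc n) x y ≈ y * binomialSum a n x y + x * binomialSum (λ k → a (suc k)) n x y
  binomialSum-suc a n x y = begin
    sumTo (suc n) T                                                   ≈⟨ sumTo-uncons n T ⟩
    T 0 + sumTo n (λ k → T (suc k))                                   ≈⟨ +-congˡ (sumTo-cong n (λ {k} _ → T-pascal k)) ⟩
    T 0 + sumTo n (λ k → y * t (suc k) + x * e k)                     ≈⟨ +-congˡ (sumTo-distrib-+ n _ _) ⟩
    T 0 + (sumTo n (λ k → y * t (suc k)) + sumTo n (λ k → x * e k))   ≈⟨ +-assoc _ _ _ ⟨
    T 0 + sumTo n (λ k → y * t (suc k)) + sumTo n (λ k → x * e k)     ≈⟨ +-cong y-part (*-distribˡ-sumTo x n e) ⟨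
    y * sumTo n t + x * sumTo n e                                     ∎
    where
      T t e : ℕ → Carrier
      T k = a k * binom (suc n) k * pow x k * pow y (suc n ∸ k)
      t k = a k * binom n k * pow x k * pow y (n ∸ k)
      e k = a (suc k) * binom n k * pow x k * pow y (n ∸ k)

      T-pascal : ∀ k → T (suc k) ≈ y * t (suc k) + x * e k
      T-pascal k = begin
        A * binom (suc n) (suc k) * (x * X) * Y             ≈⟨ *-congʳ (*-congʳ (*-congˡ (binom-pascal n k))) ⟩
        A * (B₀ + B₁) * (x * X) * Y                         ≈⟨ split ⟩
        A * (x * X) * (B₁ * Y) + x * e k                    ≈⟨ +-congʳ (*-congˡ (binom-suc-*-pow-∸ n k y)) ⟩
        A * (x * X) * (y * (B₁ * Y′)) + x * e k             ≈⟨ +-congʳ regroup ⟩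
        y * t (suc k) + x * e k                             ∎
        where
          A = a (suc k)
          B₀ = binom n k
          B₁ = binom n (suc k)
          X = pow x k
          Y = pow y (n ∸ k)
          Y′ = pow y (n ∸ suc k)
          split : A * (B₀ + B₁) * (x * X) * Y ≈ A * (x * X) * (B₁ * Y) + x * e k
          split = solve 7 (λ A B₀ B₁ x X Y y → A :* (B₀ :+ B₁) :* (x :* X) :* Y
                                              := A :* (x :* X) :* (B₁ :* Y) :+ x :* (A :* B₀ :* X :* Y))
                    refl A B₀ B₁ x X Y y
          regroup : A * (x * X) * (y * (B₁ * Y′)) ≈ y * t (suc k)
          regroup = solve 6 (λ A x X y B₁ Y′ → A :* (x :* X) :* (y :* (B₁ :* Y′)) := y :* (A :* B₁ :* (x :* X) :* Y′))
                      refl A x X y B₁ Y′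

      top-vanishes : sumTo (suc n) t ≈ sumTo n t
      top-vanishes = begin
        sumTo n t + a (suc n) * binom n (suc n) * pow x (suc n) * pow y (n ∸ suc n)
          ≈⟨ +-congˡ (*-congʳ (*-congʳ (*-congˡ (binom-vanishes (ℕ.n<1+n n))))) ⟩
        sumTo n t + a (suc n) * 0# * pow x (suc n) * pow y (n ∸ suc n)
          ≈⟨ solve 4 (λ S A X Y → S :+ A :* :0 :* X :* Y := S) refl _ _ _ _ ⟩
        sumTo n t ∎

      y-part : y * sumTo n t ≈ T 0 + sumTo n (λ k → y * t (suc k))
      y-part = begin
        y * sumTo n t                                     ≈⟨ *-congˡ top-vanishes ⟨
        y * sumTo (suc n) t                               ≈⟨ *-congˡ (sumTo-uncons n t) ⟩
        y * (t 0 + sumTo n (λ k → t (suc k)))             ≈⟨ distribˡ y _ _ ⟩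
        y * t 0 + y * sumTo n (λ k → t (suc k))           ≈⟨ +-cong (sym (x∙yz≈y∙xz _ y _)) (*-distribˡ-sumTo y n _) ⟩
        T 0 + sumTo n (λ k → y * t (suc k))               ∎

  binomialSum-1#-0# : ∀ a n → binomialSum a n 1# 0# ≈ a n
  binomialSum-1#-0# a zero    = binomialSum-zero a 1# 0#
  binomialSum-1#-0# a (suc n) = begin
    binomialSum a (suc n) 1# 0#                                        ≈⟨ binomialSum-suc a n 1# 0# ⟩
    0# * binomialSum a n 1# 0# + 1# * binomialSum (λ k → a (suc k)) n 1# 0#
                                                                       ≈⟨ solve 2 (λ U V → :0 :* U :+ :1 :* V := V) refl _ _ ⟩
    binomialSum (λ k → a (suc k)) n 1# 0#                              ≈⟨ binomialSum-1#-0# (λ k → a (suc k)) n ⟩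
    a (suc n)                                                          ∎

  binomialSum-compose : ∀ n a {x y x′ y′ X Y} → X ≈ x′ * x → Y ≈ y′ + x′ * y →
    binomialSum (λ k → binomialSum a k x y) n x′ y′ ≈ binomialSum a n X Y
  binomialSum-compose zero a {x} {y} {x′} {y′} {X} {Y} _ _ = begin
    binomialSum (λ k → binomialSum a k x y) 0 x′ y′   ≈⟨ binomialSum-zero (λ k → binomialSum a k x y) x′ y′ ⟩
    binomialSum a 0 x y                               ≈⟨ binomialSum-zero a x y ⟩
    a 0                                               ≈⟨ binomialSum-zero a X Y ⟨
    binomialSum a 0 X Y                               ∎
  binomialSum-compose (suc n) a {x} {y} {x′} {y′} {X} {Y} X≈ Y≈ = begin
    G b (suc n) x′ y′                                  ≈⟨ binomialSum-suc b n x′ y′ ⟩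
    y′ * G b n x′ y′ + x′ * G (λ k → b (suc k)) n x′ y′
                                                       ≈⟨ +-congˡ (*-congˡ (binomialSum-cong n x′ y′ (λ k → binomialSum-suc a k x y))) ⟩
    y′ * G b n x′ y′ + x′ * G (λ k → y * b k + x * b⁺ k) n x′ y′
                                                       ≈⟨ +-congˡ (*-congˡ (binomialSum-linear n y x b b⁺ x′ y′)) ⟩
    y′ * G b n x′ y′ + x′ * (y * G b n x′ y′ + x * G b⁺ n x′ y′)
                                                       ≈⟨ +-cong (*-congˡ ih) (*-congˡ (+-cong (*-congˡ ih) (*-congˡ ih⁺))) ⟩
    y′ * Z + x′ * (y * Z + x * Z⁺)                     ≈⟨ solve 6 (λ y′ x′ y x Z Z⁺ → y′ :* Z :+ x′ :* (y :* Z :+ x :* Z⁺)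
                                                                                 := (y′ :+ x′ :* y) :* Z :+ (x′ :* x) :* Z⁺)
                                                              refl y′ x′ y x Z Z⁺ ⟩
    (y′ + x′ * y) * Z + (x′ * x) * Z⁺                   ≈⟨ +-cong (*-congʳ Y≈) (*-congʳ X≈) ⟨
    Y * Z + X * Z⁺                                     ≈⟨ binomialSum-suc a n X Y ⟨
    G a (suc n) X Y                                    ∎
    where
      G = binomialSum
      b b⁺ : ℕ → Carrier
      b k = G a k x y
      b⁺ k = G (λ j → a (suc j)) k x y
      Z = G a n X Y
      Z⁺ = G (λ j → a (suc j)) n X Y
      ih : G b n x′ y′ ≈ Z
      ih = binomialSum-compose n a X≈ Y≈
      ih⁺ : G b⁺ n x′ y′ ≈ Z⁺
      ih⁺ = binomialSum-compose n (λ j → a (suc j)) X≈ Y≈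

  binomialSum-homogeneous : ∀ a n u w z →
    pow u n * binomialSum a n w z ≈ binomialSum a n (w * u) (z * u)
  binomialSum-homogeneous a n u w z =
    trans (*-distribˡ-sumTo (pow u n) n _) (sumTo-cong n absorb)
    where
      absorb : ∀ {k} → k ≤ n →
        pow u n * (a k * binom n k * pow w k * pow z (n ∸ k)) ≈ a k * binom n k * pow (w * u) k * pow (z * u) (n ∸ k)
      absorb {k} k≤n = begin
        pow u n * t                                                  ≡⟨ cong (λ i → pow u i * t) (ℕ.m+[n∸m]≡n k≤n) ⟨
        pow u (k ℕ.+ (n ∸ k)) * t                                    ≈⟨ *-congʳ (pow-+ u k (n ∸ k)) ⟩
        pow u k * pow u (n ∸ k) * t                                  ≈⟨ regroup ⟩
        a k * B * (pow w k * pow u k) * (pow z (n ∸ k) * pow u (n ∸ k))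
                                                                     ≈⟨ *-cong (*-congˡ (pow-distrib-* w u k)) (pow-distrib-* z u (n ∸ k)) ⟨
        a k * B * pow (w * u) k * pow (z * u) (n ∸ k)                ∎
        where
          B = binom n k
          t = a k * B * pow w k * pow z (n ∸ k)
          regroup : pow u k * pow u (n ∸ k) * t ≈ a k * B * (pow w k * pow u k) * (pow z (n ∸ k) * pow u (n ∸ k))
          regroup = solve 6 (λ U V A B W Z → U :* V :* (A :* B :* W :* Z) := A :* B :* (W :* U) :* (Z :* V))
                      refl (pow u k) (pow u (n ∸ k)) (a k) B (pow w k) (pow z (n ∸ k))

  pow≈1-[1-q]*qint : ∀ q m → pow q m ≈ 1# - (1# - q) * qint m q
  pow≈1-[1-q]*qint q zero    = solve 1 (λ q → :1 := :1 :- (:1 :- q) :* :0) refl q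
  pow≈1-[1-q]*qint q (suc m) = begin
    q * P                                   ≈⟨ solve 2 (λ q P → q :* P := P :- (:1 :- q) :* P) refl q P ⟩
    P - (1# - q) * P                        ≈⟨ +-congʳ (pow≈1-[1-q]*qint q m) ⟩
    1# - (1# - q) * Q - (1# - q) * P        ≈⟨ solve 3 (λ q Q P → :1 :- (:1 :- q) :* Q :- (:1 :- q) :* P
                                                               := :1 :- (:1 :- q) :* (Q :+ P)) refl q Q P ⟩
    1# - (1# - q) * (Q + P)                 ∎
    where
      P = pow q m
      Q = qint m q

  S-pow-expansion₁ : ∀ a q m n →
    S a n (pow q m) ≈ binomialSum (λ k → S a k (1# - qint m q)) n (1# - q) q
  S-pow-expansion₁ a q m n = sym (binomialSum-compose n a X≈ Y≈)
    where
      Q = qint m q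
      X≈ : 1# - pow q m ≈ (1# - q) * (1# - (1# - Q))
      X≈ = begin
        1# - pow q m                    ≈⟨ +-congˡ (-‿cong (pow≈1-[1-q]*qint q m)) ⟩
        1# - (1# - (1# - q) * Q)        ≈⟨ solve 2 (λ q Q → :1 :- (:1 :- (:1 :- q) :* Q) := (:1 :- q) :* (:1 :- (:1 :- Q))) refl q Q ⟩
        (1# - q) * (1# - (1# - Q))      ∎
      Y≈ : pow q m ≈ q + (1# - q) * (1# - Q)
      Y≈ = begin
        pow q m                         ≈⟨ pow≈1-[1-q]*qint q m ⟩
        1# - (1# - q) * Q               ≈⟨ solve 2 (λ q Q → :1 :- (:1 :- q) :* Q := q :+ (:1 :- q) :* (:1 :- Q)) refl q Q ⟩
        q + (1# - q) * (1# - Q)         ∎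

  S-pow-expansion₂ : ∀ a q m n →
    S a n (pow q m) ≈ binomialSum (λ k → S a k q) n (qint m q) (1# - qint m q)
  S-pow-expansion₂ a q m n = sym (binomialSum-compose n a X≈ Y≈)
    where
      Q = qint m q
      X≈ : 1# - pow q m ≈ Q * (1# - q)
      X≈ = begin
        1# - pow q m                    ≈⟨ +-congˡ (-‿cong (pow≈1-[1-q]*qint q m)) ⟩
        1# - (1# - (1# - q) * Q)        ≈⟨ solve 2 (λ q Q → :1 :- (:1 :- (:1 :- q) :* Q) := Q :* (:1 :- q)) refl q Q ⟩
        Q * (1# - q)                    ∎
      Y≈ : pow q m ≈ (1# - Q) + Q * q
      Y≈ = begin
        pow q m                         ≈⟨ pow≈1-[1-q]*qint q m ⟩
        1# - (1# - q) * Q               ≈⟨ solve 2 (λ q Q → :1 :- (:1 :- q) :* Q := (:1 :- Q) :+ Q :* q) refl q Q ⟩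
        (1# - Q) + Q * q                ∎

  inversion₁ : ∀ a q u → u * (1# - q) ≈ 1# → ∀ n →
    a n ≈ binomialSum (λ k → S a k (- (q * u))) n (1# - q) q
  inversion₁ a q u u[1-q]≈1 n = trans (sym (binomialSum-1#-0# a n)) (sym (binomialSum-compose n a X≈ Y≈))
    where
      X≈ : 1# ≈ (1# - q) * (1# - - (q * u))
      X≈ = begin
        1#                              ≈⟨ solve 1 (λ q → :1 := (:1 :- q) :+ q :* :1) refl q ⟩
        (1# - q) + q * 1#               ≈⟨ +-congˡ (*-congˡ u[1-q]≈1) ⟨
        (1# - q) + q * (u * (1# - q))   ≈⟨ solve 2 (λ q u → (:1 :- q) :+ q :* (u :* (:1 :- q)) := (:1 :- q) :* (:1 :- :- (q :* u))) refl q u ⟩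
        (1# - q) * (1# - - (q * u))     ∎
      Y≈ : 0# ≈ q + (1# - q) * - (q * u)
      Y≈ = begin
        0#                              ≈⟨ solve 1 (λ q → :0 := q :- q :* :1) refl q ⟩
        q - q * 1#                      ≈⟨ +-congˡ (-‿cong (*-congˡ u[1-q]≈1)) ⟨
        q - q * (u * (1# - q))          ≈⟨ solve 2 (λ q u → q :- q :* (u :* (:1 :- q)) := q :+ (:1 :- q) :* :- (q :* u)) refl q u ⟩
        q + (1# - q) * - (q * u)        ∎

  inversion₂ : ∀ a q u → u * (1# - q) ≈ 1# → ∀ n →
    a n ≈ pow u n * sumTo n (λ k → S a k q * binom n k * pow (- q) (n ∸ k))
  inversion₂ a q u u[1-q]≈1 n = begin
    a n                                                ≈⟨ binomialSum-1#-0# a n ⟨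
    binomialSum a n 1# 0#                              ≈⟨ binomialSum-compose n a X≈ Y≈ ⟨
    binomialSum (λ k → S a k q) n (1# * u) (- q * u)   ≈⟨ binomialSum-homogeneous (λ k → S a k q) n u 1# (- q) ⟨
    pow u n * binomialSum (λ k → S a k q) n 1# (- q)   ≈⟨ *-congˡ (sumTo-cong n (λ {k} _ → *-congʳ (trans (*-congˡ (pow-1# k)) (*-identityʳ _)))) ⟩
    pow u n * sumTo n (λ k → S a k q * binom n k * pow (- q) (n ∸ k)) ∎
    where
      X≈ : 1# ≈ (1# * u) * (1# - q)
      X≈ = trans (sym u[1-q]≈1) (*-congʳ (sym (*-identityˡ u)))
      Y≈ : 0# ≈ - q * u + (1# * u) * q
      Y≈ = solve 2 (λ q u → :0 := :- q :* u :+ (:1 :* u) :* q) refl q u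

  dilation₁ : ∀ a α q u → u * (1# - q) ≈ 1# → ∀ n →
    S a n ((α + 1#) * q) ≈ binomialSum (λ k → S a k (α * q * u)) n (1# - q) q
  dilation₁ a α q u u[1-q]≈1 n = sym (binomialSum-compose n a X≈ Y≈)
    where
      X≈ : 1# - (α + 1#) * q ≈ (1# - q) * (1# - α * q * u)
      X≈ = begin
        1# - (α + 1#) * q                  ≈⟨ solve 2 (λ α q → :1 :- (α :+ :1) :* q := (:1 :- q) :- α :* q :* :1) refl α q ⟩
        (1# - q) - α * q * 1#              ≈⟨ +-congˡ (-‿cong (*-congˡ u[1-q]≈1)) ⟨
        (1# - q) - α * q * (u * (1# - q))  ≈⟨ solve 3 (λ α q u → (:1 :- q) :- α :* q :* (u :* (:1 :- q))
                                                                := (:1 :- q) :* (:1 :- α :* q :* u)) refl α q u ⟩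
        (1# - q) * (1# - α * q * u)        ∎
      Y≈ : (α + 1#) * q ≈ q + (1# - q) * (α * q * u)
      Y≈ = begin
        (α + 1#) * q                     ≈⟨ solve 2 (λ α q → (α :+ :1) :* q := q :+ α :* q :* :1) refl α q ⟩
        q + α * q * 1#                   ≈⟨ +-congˡ (*-congˡ u[1-q]≈1) ⟨
        q + α * q * (u * (1# - q))       ≈⟨ solve 3 (λ α q u → q :+ α :* q :* (u :* (:1 :- q)) := q :+ (:1 :- q) :* (α :* q :* u)) refl α q u ⟩
        q + (1# - q) * (α * q * u)       ∎

  dilation₂ : ∀ a α q u → u * (1# - q) ≈ 1# → ∀ n →
    S a n ((α + 1#) * q) ≈ pow u n * binomialSum (λ k → S a k q) n (1# - (α + 1#) * q) (α * q)
  dilation₂ a α q u u[1-q]≈1 n = begin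
    S a n ((α + 1#) * q)                                 ≈⟨ binomialSum-compose n a X≈ Y≈ ⟨
    binomialSum (λ k → S a k q) n (w * u) (α * q * u)    ≈⟨ binomialSum-homogeneous (λ k → S a k q) n u w (α * q) ⟨
    pow u n * binomialSum (λ k → S a k q) n w (α * q)    ∎
    where
      w = 1# - (α + 1#) * q
      X≈ : w ≈ w * u * (1# - q)
      X≈ = begin
        w                                ≈⟨ *-identityʳ w ⟨
        w * 1#                           ≈⟨ *-congˡ u[1-q]≈1 ⟨
        w * (u * (1# - q))               ≈⟨ *-assoc w u _ ⟨
        w * u * (1# - q)                 ∎
      Y≈ : (α + 1#) * q ≈ α * q * u + w * u * q
      Y≈ = begin
        (α + 1#) * q                     ≈⟨ *-identityʳ _ ⟨
        (α + 1#) * q * 1#                ≈⟨ *-congˡ u[1-q]≈1 ⟨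
        (α + 1#) * q * (u * (1# - q))    ≈⟨ solve 3 (λ α q u → (α :+ :1) :* q :* (u :* (:1 :- q))
                                                             := α :* q :* u :+ (:1 :- (α :+ :1) :* q) :* u :* q) refl α q u ⟩
        α * q * u + w * u * q            ∎

mainTheorem7 : ∀ {c ℓ} (R : CommutativeRing c ℓ) →
    let open CommutativeRing R
        open Ops R
    in (a : ℕ → Carrier) →
       -- first pair of identities: any q, any positive integer m, every n
       ((q : Carrier) (m : ℕ) → 1 ≤ m → (n : ℕ) →
          (S a n (pow q m) ≈ sumTo n (λ k → S a k (1# - qint m q) * binom n k * pow (1# - q) k * pow q (n ∸ k)))
          × (S a n (pow q m) ≈ sumTo n (λ k → S a k q * binom n k * pow (qint m q) k * pow (1# - qint m q) (n ∸ k))))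
       -- inversion formulas; u is the inverse 1/(1-q)
       × ((q u : Carrier) → u * (1# - q) ≈ 1# → (n : ℕ) →
          (a n ≈ sumTo n (λ k → S a k (- (q * u)) * binom n k * pow (1# - q) k * pow q (n ∸ k)))
          × (a n ≈ pow u n * sumTo n (λ k → S a k q * binom n k * pow (- q) (n ∸ k))))
       -- dilation formulas, any α, q ≠ 1 (u = 1/(1-q))
       × ((α q u : Carrier) → u * (1# - q) ≈ 1# → (n : ℕ) →
          (S a n ((α + 1#) * q) ≈ sumTo n (λ k → S a k (α * q * u) * binom n k * pow (1# - q) k * pow q (n ∸ k)))
          × (S a n ((α + 1#) * q) ≈ pow u n * sumTo n (λ k → S a k q * binom n k * pow (1# - (α + 1#) * q) k * pow (α * q) (n ∸ k))))
mainTheorem7 R a =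
  (λ q m _ n → S-pow-expansion₁ a q m n , S-pow-expansion₂ a q m n) ,
  (λ q u u[1-q]≈1 n → inversion₁ a q u u[1-q]≈1 n , inversion₂ a q u u[1-q]≈1 n) ,
  (λ α q u u[1-q]≈1 n → dilation₁ a α q u u[1-q]≈1 n , dilation₂ a α q u u[1-q]≈1 n)
  where open BinomialSums R
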